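{- Let $D$ be a digraph on $k$ vertices whose skew adjacency matrix $A_D$ satisfies $\ker(A_D)=\operatorname{span}(\mathbf{1})$. Then there is a constant $\alpha_D>0$ such that for every probability vector $p$ indexed by $V(D)$ (nonnegative entries summing to $1$), \[\max_{v\in V(D)}\Big\{\sum_{u\in N^+(v)}p_u-\sum_{u\in N^-(v)}p_u\Big\}\ge\alpha_D\max_{v\in V(D)}|p_v-1/k|.\]
   Context: A digraph $D$ has a finite vertex set $V(D)$ and a set $E(D)$ of ordered pairs of distinct vertices (arcs), with at most one arc between any pair. $N^+(v)=\{u:vu\in E(D)\}$, $N^-(v)=\{u:uv\in E(D)\}$. The skew adjacency matrix $A_D$ is indexed by $V(D)$ with $(A_D)_{ij}=1$ if $ij\in E(D)$, $-1$ if $ji\in E(D)$, and $0$ otherwise. $\mathbf{1}$ is the all-ones vector.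
   Formalization: The probability vectors p have rational entries, the kernel of $A_D$ is taken over ℚ, and the constant $\alpha_D$ is taken in ℚ. -}

module Defs where

open import Data.Nat using (ℕ; zero; suc)
open import Data.Fin using (Fin; zero; suc)
open import Data.Bool using (Bool; true; false; if_then_else_)
open import Data.Integer using (+_)
open import Data.Rational using (ℚ; 0ℚ; 1ℚ; _+_; _-_; _*_; -_; _⊔_)
open import Relation.Binary.PropositionalEquality using (_≡_)

record Digraph (k : ℕ) : Set where
  field
    arc        : Fin k → Fin k → Bool
    loopless   : ∀ v → arc v v ≡ false
    antisym    : ∀ u v → arc u v ≡ true → arc v u ≡ false
open Digraph public

Σ : ∀ {n} → (Fin n → ℚ) → ℚ
Σ {zero}  f = 0ℚ
Σ {suc n} f = f zero + Σ (λ i → f (suc i))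

maxFrom : ∀ {n} → ℚ → (Fin n → ℚ) → ℚ
maxFrom {zero}  a f = a
maxFrom {suc n} a f = maxFrom (a ⊔ f zero) (λ i → f (suc i))

-- maximum over a nonempty finite index set; (conventionally 0 when empty,
-- never used in that case)
maxF : ∀ {n} → (Fin n → ℚ) → ℚ
maxF {zero}  f = 0ℚ
maxF {suc n} f = maxFrom (f zero) (λ i → f (suc i))

skewAdj : ∀ {k} → Digraph k → Fin k → Fin k → ℚ
skewAdj D i j =
  if arc D i j then 1ℚ else (if arc D j i then - 1ℚ else 0ℚ)

mulVec : ∀ {k} → (Fin k → Fin k → ℚ) → (Fin k → ℚ) → Fin k → ℚ
mulVec A x i = Σ (λ j → A i j * x j)

InKernel : ∀ {k} → (Fin k → Fin k → ℚ) → (Fin k → ℚ) → Set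
InKernel A x = ∀ i → mulVec A x i ≡ 0ℚ

InSpanOnes : ∀ {k} → (Fin k → ℚ) → Set
InSpanOnes {k} x = Data.Product.Σ ℚ (λ c → ∀ i → x i ≡ c * 1ℚ)
  where import Data.Product

KernelIsSpanOnes : ∀ {k} → (Fin k → Fin k → ℚ) → Set
KernelIsSpanOnes {k} A =
  ∀ (x : Fin k → ℚ) → (InKernel A x → InSpanOnes x) × (InSpanOnes x → InKernel A x)
  where open import Data.Product using (_×_)

outMinusIn : ∀ {k} → Digraph k → (Fin k → ℚ) → Fin k → ℚ
outMinusIn D p v =
  Σ (λ u → if arc D v u then p u else 0ℚ) - Σ (λ u → if arc D u v then p u else 0ℚ)

-- Let A be the skew adjacency matrix and x = A p. Since A is skew and A𝟙 = 0, also 𝟙ᵀA = 0, so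
-- the entries of x sum to zero; hence m = max x is nonnegative and |x_v| ≤ (1 + k) m for all v.
-- Since ker A = span 𝟙, the Fredholm alternative (proved by Gaussian elimination) puts every vector
-- orthogonal to 𝟙 into the row space of A, so e_i − 𝟙/k = b_iᵀ A for some b_i. As Σ p = 1,
-- p_i − 1/k = (e_i − 𝟙/k) · p = b_i · x, whence |p_i − 1/k| ≤ ‖b_i‖₁ (1 + k) m, and
-- α = 1 / ((1 + Σ_i ‖b_i‖₁) (1 + k)) works.

module Submission where

open import Algebra.Bundles using (CommutativeRing)
open import Data.Bool using (true; false; if_then_else_)
open import Data.Fin using (Fin; zero; suc; punchIn)
open import Data.Fin.Properties using (all?; ¬∀⟶∃¬)
open import Data.Integer as ℤ using (ℤ; +_)
import Data.Integer.Properties as ℤ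
open import Data.Nat using (ℕ; NonZero; zero; suc)
open import Data.Product using (Σ-syntax; ∃-syntax; _×_; _,_; proj₁; proj₂)
open import Data.Rational
  using ( ℚ; 0ℚ; 1ℚ; _/_; _+_; _-_; _*_; -_; 1/_; _≤_; _<_; ∣_∣; _⊔_; toℚᵘ
        ; Positive; ≢-nonZero; positive; nonNegative)
open import Data.Rational.Properties as ℚ
  using ( _≟_; ≤-refl; ≤-trans; <-≤-trans; +-mono-≤; +-monoˡ-≤; +-monoʳ-≤
        ; *-monoˡ-≤-nonNeg; *-monoʳ-≤-nonNeg)
open import Data.Rational.Solver using (module +-*-Solver)
import Data.Rational.Unnormalised as ℚᵘ
import Data.Rational.Unnormalised.Properties as ℚᵘ
open import Data.Sum using (_⊎_; inj₁; inj₂)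
open import Data.Vec.Functional using (Vector; _∷_; tail)
open import Function using (_∘_; const)
open import Relation.Binary.PropositionalEquality
open import Relation.Nullary using (yes; no; contradiction)

open import Defs

open import Algebra.Properties.Semiring.Sum (CommutativeRing.semiring ℚ.+-*-commutativeRing)
  using ( sum; sum-cong-≗; sum-replicate-zero; sum-remove; ∑-distrib-+; ∑-comm
        ; *-distribˡ-sum; *-distribʳ-sum)

open +-*-Solver

p≤q+p : ∀ {p q} → 0ℚ ≤ q → p ≤ q + p
p≤q+p {p} {q} 0≤q = subst (_≤ q + p) (ℚ.+-identityˡ p) (+-monoˡ-≤ p 0≤q)

p≤p+q : ∀ {p q} → 0ℚ ≤ q → p ≤ p + q
p≤p+q {p} {q} 0≤q = subst (p ≤_) (ℚ.+-comm q p) (p≤q+p 0≤q)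

0<1+p : ∀ {p} → 0ℚ ≤ p → 0ℚ < 1ℚ + p
0<1+p 0≤p = <-≤-trans (ℚ.positive⁻¹ 1ℚ) (p≤p+q 0≤p)

∣p∣≤q : ∀ {p q} → p ≤ q → - p ≤ q → ∣ p ∣ ≤ q
∣p∣≤q {p} {q} p≤q -p≤q with ℚ.∣p∣≡p∨∣p∣≡-p p
... | inj₁ ∣p∣≡p  = subst (_≤ q) (sym ∣p∣≡p) p≤q
... | inj₂ ∣p∣≡-p = subst (_≤ q) (sym ∣p∣≡-p) -p≤q

inverse-bound : ∀ {C} → 0ℚ < C → Σ[ α ∈ ℚ ] (0ℚ < α × ∀ {a m} → a ≤ C * m → α * a ≤ m)
inverse-bound {C} 0<C = 1/ C , ℚ.positive⁻¹ (1/ C) {{ℚ.1/pos⇒pos C}} , α*≤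
  where
  instance
    C-pos : Positive C
    C-pos = positive 0<C
    C-nonZero : Data.Rational.NonZero C
    C-nonZero = ℚ.pos⇒nonZero C
  α*≤ : ∀ {a m} → a ≤ C * m → 1/ C * a ≤ m
  α*≤ {a} {m} a≤C*m = begin
    1/ C * a         ≤⟨ *-monoˡ-≤-nonNeg (1/ C) {{ℚ.pos⇒nonNeg (1/ C) {{ℚ.1/pos⇒pos C}}}} a≤C*m ⟩
    1/ C * (C * m)   ≡⟨ ℚ.*-assoc (1/ C) C m ⟨
    (1/ C * C) * m   ≡⟨ cong (_* m) (ℚ.*-inverseˡ C) ⟩
    1ℚ * m           ≡⟨ ℚ.*-identityˡ m ⟩
    m                ∎
    where open ℚ.≤-Reasoning

+-/ : ∀ (i j : ℤ) d → i / suc d + j / suc d ≡ (i ℤ.+ j) / suc d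
+-/ i j d = ℚ.toℚᵘ-injective (begin
  toℚᵘ (i / suc d + j / suc d)            ≈⟨ ℚ.toℚᵘ-homo-+ (i / suc d) (j / suc d) ⟩
  toℚᵘ (i / suc d) ℚᵘ.+ toℚᵘ (j / suc d)  ≈⟨ ℚᵘ.+-cong (ℚ.toℚᵘ-fromℚᵘ (ℚᵘ.mkℚᵘ i d))
                                                         (ℚ.toℚᵘ-fromℚᵘ (ℚᵘ.mkℚᵘ j d)) ⟩
  ℚᵘ.mkℚᵘ i d ℚᵘ.+ ℚᵘ.mkℚᵘ j d           ≈⟨ ℚᵘ.*≡* cross ⟩
  ℚᵘ.mkℚᵘ (i ℤ.+ j) d                     ≈⟨ ℚ.toℚᵘ-fromℚᵘ (ℚᵘ.mkℚᵘ (i ℤ.+ j) d) ⟨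
  toℚᵘ ((i ℤ.+ j) / suc d)                ∎)
  where
  open ℚᵘ.≃-Reasoning
  k : ℤ
  k = + suc d
  cross : (i ℤ.* k ℤ.+ j ℤ.* k) ℤ.* k ≡ (i ℤ.+ j) ℤ.* (k ℤ.* k)
  cross = trans (cong (ℤ._* k) (sym (ℤ.*-distribʳ-+ k i j))) (ℤ.*-assoc (i ℤ.+ j) k k)

Σ≡sum : ∀ {n} (f : Vector ℚ n) → Σ f ≡ sum f
Σ≡sum {zero}  f = refl
Σ≡sum {suc n} f = cong (λ s → f zero + s) (Σ≡sum (f ∘ suc))

∑-neg : ∀ {n} (f : Vector ℚ n) → sum (λ i → - f i) ≡ - sum f
∑-neg {zero}  f = refl
∑-neg {suc n} f =
  trans (cong (λ s → - f zero + s) (∑-neg (f ∘ suc))) (sym (ℚ.neg-distrib-+ (f zero) (sum (f ∘ suc))))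

∑-distrib-sub : ∀ {n} (f g : Vector ℚ n) → sum (λ i → f i - g i) ≡ sum f - sum g
∑-distrib-sub f g = trans (∑-distrib-+ f (λ i → - g i)) (cong (λ s → sum f + s) (∑-neg g))

∑-linear : ∀ {n} (f : Vector ℚ n) c (g : Vector ℚ n) →
           sum (λ i → f i - c * g i) ≡ sum f - c * sum g
∑-linear f c g = trans (∑-distrib-sub f (λ i → c * g i)) (cong (λ s → sum f - s) (sym (*-distribˡ-sum c g)))

∑-mono-≤ : ∀ {n} {f g : Vector ℚ n} → (∀ i → f i ≤ g i) → sum f ≤ sum g
∑-mono-≤ {zero}  f≤g = ≤-refl
∑-mono-≤ {suc n} f≤g = +-mono-≤ (f≤g zero) (∑-mono-≤ (f≤g ∘ suc))

∑-nonNeg : ∀ {n} {f : Vector ℚ n} → (∀ i → 0ℚ ≤ f i) → 0ℚ ≤ sum f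
∑-nonNeg {n} {f} f≥0 = subst (_≤ sum f) (sum-replicate-zero n) (∑-mono-≤ f≥0)

≤-∑ : ∀ {n} {f : Vector ℚ n} → (∀ i → 0ℚ ≤ f i) → ∀ i → f i ≤ sum f
≤-∑ {suc n} {f} f≥0 i =
  subst (f i ≤_) (sym (sum-remove f)) (p≤p+q (∑-nonNeg (f≥0 ∘ punchIn i)))

∣∑∣≤∑∣∣ : ∀ {n} (f : Vector ℚ n) → ∣ sum f ∣ ≤ sum (λ i → ∣ f i ∣)
∣∑∣≤∑∣∣ {zero}  f = ≤-refl
∣∑∣≤∑∣∣ {suc n} f =
  ≤-trans (ℚ.∣p+q∣≤∣p∣+∣q∣ (f zero) _) (+-monoʳ-≤ ∣ f zero ∣ (∣∑∣≤∑∣∣ (f ∘ suc)))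

∑-1/n : ∀ n .{{_ : NonZero n}} → sum {n} (const (+ 1 / n)) ≡ 1ℚ
∑-1/n (suc d) = trans (∑-const (suc d)) n/n≡1
  where
  ∑-const : ∀ a → sum {a} (const (+ 1 / suc d)) ≡ + a / suc d
  ∑-const zero    = sym (ℚ.0/n≡0 (suc d))
  ∑-const (suc a) = trans (cong (λ s → + 1 / suc d + s) (∑-const a)) (+-/ (+ 1) (+ a) d)
  n/n≡1 : + suc d / suc d ≡ 1ℚ
  n/n≡1 = ℚ.toℚᵘ-injective
    (ℚᵘ.≃-trans (ℚ.toℚᵘ-fromℚᵘ (ℚᵘ.mkℚᵘ (+ suc d) d)) (ℚᵘ.*≡* (ℤ.*-comm (+ suc d) (+ 1))))

infix 7 _·_ _*ᵥ_ _ᵥ*_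

_·_ : ∀ {n} → Vector ℚ n → Vector ℚ n → ℚ
u · v = sum (λ i → u i * v i)

Matrix : ℕ → ℕ → Set
Matrix n m = Fin n → Fin m → ℚ

_*ᵥ_ : ∀ {n m} → Matrix n m → Vector ℚ m → Vector ℚ n
(M *ᵥ z) i = M i · z

_ᵥ*_ : ∀ {n m} → Vector ℚ n → Matrix n m → Vector ℚ m
(b ᵥ* M) j = b · (λ i → M i j)

·-comm : ∀ {n} (u v : Vector ℚ n) → u · v ≡ v · u
·-comm u v = sum-cong-≗ (λ i → ℚ.*-comm (u i) (v i))

·-zeroʳ : ∀ {n} (u : Vector ℚ n) → u · const 0ℚ ≡ 0ℚ
·-zeroʳ {n} u = trans (sum-cong-≗ (λ i → ℚ.*-zeroʳ (u i))) (sum-replicate-zero n)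

ᵥ*-· : ∀ {n m} (b : Vector ℚ n) (M : Matrix n m) (z : Vector ℚ m) → (b ᵥ* M) · z ≡ b · (M *ᵥ z)
ᵥ*-· b M z = begin
  sum (λ j → sum (λ i → b i * M i j) * z j)   ≡⟨ sum-cong-≗ (λ j → *-distribʳ-sum (z j) (λ i → b i * M i j)) ⟩
  sum (λ j → sum (λ i → b i * M i j * z j))   ≡⟨ sum-cong-≗ (λ j → sum-cong-≗ (λ i → ℚ.*-assoc (b i) (M i j) (z j))) ⟩
  sum (λ j → sum (λ i → b i * (M i j * z j))) ≡⟨ ∑-comm (λ i j → b i * (M i j * z j)) ⟨
  sum (λ i → sum (λ j → b i * (M i j * z j))) ≡⟨ sum-cong-≗ (λ i → *-distribˡ-sum (b i) (λ j → M i j * z j)) ⟨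
  sum (λ i → b i * (M i · z))                 ∎
  where open ≡-Reasoning

‖_‖₁ : ∀ {n} → Vector ℚ n → ℚ
‖ u ‖₁ = sum (λ v → ∣ u v ∣)

∣·∣≤‖‖₁* : ∀ {n} (b x : Vector ℚ n) {c} → (∀ v → ∣ x v ∣ ≤ c) → ∣ b · x ∣ ≤ ‖ b ‖₁ * c
∣·∣≤‖‖₁* b x {c} ∣x∣≤c = begin
  ∣ b · x ∣                      ≤⟨ ∣∑∣≤∑∣∣ (λ v → b v * x v) ⟩
  sum (λ v → ∣ b v * x v ∣)      ≡⟨ sum-cong-≗ (λ v → ℚ.∣p*q∣≡∣p∣*∣q∣ (b v) (x v)) ⟩
  sum (λ v → ∣ b v ∣ * ∣ x v ∣)  ≤⟨ ∑-mono-≤ (λ v → *-monoˡ-≤-nonNeg ∣ b v ∣ {{ℚ.∣-∣-nonNeg (b v)}} (∣x∣≤c v)) ⟩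
  sum (λ v → ∣ b v ∣ * c)        ≡⟨ *-distribʳ-sum c (λ v → ∣ b v ∣) ⟨
  ‖ b ‖₁ * c                     ∎
  where open ℚ.≤-Reasoning

δ : ∀ {n} → Fin n → Vector ℚ n
δ zero    zero    = 1ℚ
δ zero    (suc _) = 0ℚ
δ (suc _) zero    = 0ℚ
δ (suc r) (suc i) = δ r i

δ-· : ∀ {n} (r : Fin n) (g : Vector ℚ n) → δ r · g ≡ g r
δ-· {suc n} zero g = begin
  1ℚ * g zero + sum (λ i → 0ℚ * g (suc i)) ≡⟨ cong₂ _+_ (ℚ.*-identityˡ (g zero)) (·-comm (const 0ℚ) (g ∘ suc)) ⟩
  g zero + (g ∘ suc) · const 0ℚ            ≡⟨ cong (λ s → g zero + s) (·-zeroʳ (g ∘ suc)) ⟩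
  g zero + 0ℚ                              ≡⟨ ℚ.+-identityʳ (g zero) ⟩
  g zero                                   ∎
  where open ≡-Reasoning
δ-· {suc n} (suc r) g = trans (cong (_+ δ r · (g ∘ suc)) (ℚ.*-zeroˡ (g zero)))
                              (trans (ℚ.+-identityˡ _) (δ-· r (g ∘ suc)))

∑-δ : ∀ {n} (r : Fin n) → sum (δ r) ≡ 1ℚ
∑-δ r = trans (sum-cong-≗ (λ i → sym (ℚ.*-identityʳ (δ r i)))) (δ-· r (const 1ℚ))

δ-const-· : ∀ {n} (r : Fin n) c (p : Vector ℚ n) → (λ j → δ r j - c) · p ≡ p r - c * sum p
δ-const-· r c p = begin
  sum (λ j → (δ r j - c) * p j)       ≡⟨ sum-cong-≗ (λ j → distrib (δ r j) (p j)) ⟩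
  sum (λ j → δ r j * p j - c * p j)   ≡⟨ ∑-linear (λ j → δ r j * p j) c p ⟩
  δ r · p - c * sum p                 ≡⟨ cong (_- c * sum p) (δ-· r p) ⟩
  p r - c * sum p                     ∎
  where
  open ≡-Reasoning
  distrib : ∀ d q → (d - c) * q ≡ d * q - c * q
  distrib d q = solve 3 (λ d c q → (d :- c) :* q := d :* q :- c :* q) refl d c q

ᵥ*-+δ : ∀ {n m} (b : Vector ℚ n) t r (M : Matrix n m) →
        (λ i → b i + t * δ r i) ᵥ* M ≗ (λ j → (b ᵥ* M) j + t * M r j)
ᵥ*-+δ b t r M j = begin
  sum (λ i → (b i + t * δ r i) * M i j)          ≡⟨ sum-cong-≗ (λ i → distrib (b i) (δ r i) (M i j)) ⟩
  sum (λ i → b i * M i j + t * (δ r i * M i j))  ≡⟨ ∑-distrib-+ (λ i → b i * M i j) (λ i → t * (δ r i * M i j)) ⟩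
  (b ᵥ* M) j + sum (λ i → t * (δ r i * M i j))   ≡⟨ cong (λ s → (b ᵥ* M) j + s) (*-distribˡ-sum t (λ i → δ r i * M i j)) ⟨
  (b ᵥ* M) j + t * (δ r · (λ i → M i j))         ≡⟨ cong (λ s → (b ᵥ* M) j + t * s) (δ-· r (λ i → M i j)) ⟩
  (b ᵥ* M) j + t * M r j                         ∎
  where
  open ≡-Reasoning
  distrib : ∀ x d y → (x + t * d) * y ≡ x * y + t * (d * y)
  distrib x d y = solve 4 (λ x d y t → (x :+ t :* d) :* y := x :* y :+ t :* (d :* y)) refl x d y t

-- The Fredholm alternative

InRowSpace : ∀ {n m} → Matrix n m → Vector ℚ m → Set
InRowSpace M y = ∃[ b ] b ᵥ* M ≗ y

KernelWitness : ∀ {n m} → Matrix n m → Vector ℚ m → Set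
KernelWitness M y = ∃[ z ] (M *ᵥ z ≗ const 0ℚ × y · z ≢ 0ℚ)

zeroColumn : ∀ {n m} (M : Matrix n (suc m)) (y : Vector ℚ (suc m)) → (∀ i → M i zero ≡ 0ℚ) →
             InRowSpace (tail ∘ M) (tail y) ⊎ KernelWitness (tail ∘ M) (tail y) →
             InRowSpace M y ⊎ KernelWitness M y
zeroColumn M y col₀≡0 (inj₂ (z , Mz≡0 , yz≢0)) =
  inj₂ (0ℚ ∷ z , (λ i → trans (0∷-· (M i)) (Mz≡0 i)) , yz≢0 ∘ trans (sym (0∷-· y)))
  where
  0∷-· : ∀ u → u · (0ℚ ∷ z) ≡ tail u · z
  0∷-· u = trans (cong (_+ tail u · z) (ℚ.*-zeroʳ (u zero))) (ℚ.+-identityˡ _)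
zeroColumn M y col₀≡0 (inj₁ (b , bM≗y)) with y zero ≟ 0ℚ
... | yes y₀≡0 = inj₁ (b , λ { zero → trans bM₀≡0 (sym y₀≡0) ; (suc j) → bM≗y j })
  where
  bM₀≡0 : (b ᵥ* M) zero ≡ 0ℚ
  bM₀≡0 = trans (sum-cong-≗ (λ i → cong (b i *_) (col₀≡0 i))) (·-zeroʳ b)
... | no y₀≢0 = inj₂ (δ zero , (λ i → trans (·-δ₀ (M i)) (col₀≡0 i)) , y₀≢0 ∘ trans (sym (·-δ₀ y)))
  where
  ·-δ₀ : ∀ u → u · δ zero ≡ u zero
  ·-δ₀ u = trans (·-comm u (δ zero)) (δ-· zero u)

-- One step of Gaussian elimination: the pivot row r clears column 0.
module Pivot {n m} (M : Matrix n (suc m)) (r : Fin n) (pivot≢0 : M r zero ≢ 0ℚ) where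

  pivot⁻¹ : ℚ
  pivot⁻¹ = (1/ M r zero) {{≢-nonZero pivot≢0}}

  pivot⁻¹*pivot≡1 : pivot⁻¹ * M r zero ≡ 1ℚ
  pivot⁻¹*pivot≡1 = ℚ.*-inverseˡ (M r zero) {{≢-nonZero pivot≢0}}

  R : Vector ℚ m
  R = tail (M r)

  eliminate : Vector ℚ (suc m) → Vector ℚ m
  eliminate u j = u (suc j) - (u zero * pivot⁻¹) * R j

  M′ : Matrix n m
  M′ = eliminate ∘ M

  extend : Vector ℚ m → Vector ℚ (suc m)
  extend z = - (pivot⁻¹ * (R · z)) ∷ z

  extend-· : ∀ u z → u · extend z ≡ eliminate u · z
  extend-· u z = begin
    u zero * - (pivot⁻¹ * (R · z)) + tail u · z
      ≡⟨ rearrange (u zero) pivot⁻¹ (R · z) (tail u · z) ⟩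
    tail u · z - (u zero * pivot⁻¹) * (R · z)
      ≡⟨ ∑-linear (λ j → u (suc j) * z j) (u zero * pivot⁻¹) (λ j → R j * z j) ⟨
    sum (λ j → u (suc j) * z j - (u zero * pivot⁻¹) * (R j * z j))
      ≡⟨ sum-cong-≗ (λ j → distrib (u (suc j)) (u zero * pivot⁻¹) (R j) (z j)) ⟩
    eliminate u · z ∎
    where
    open ≡-Reasoning
    rearrange : ∀ a p s t → a * - (p * s) + t ≡ t - (a * p) * s
    rearrange = solve 4 (λ a p s t → a :* :- (p :* s) :+ t := t :- (a :* p) :* s) refl
    distrib : ∀ x c y w → x * w - c * (y * w) ≡ (x - c * y) * w
    distrib = solve 4 (λ x c y w → x :* w :- c :* (y :* w) := (x :- c :* y) :* w) refl

  eliminate-ᵥ* : ∀ b → eliminate (b ᵥ* M) ≗ b ᵥ* M′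
  eliminate-ᵥ* b j = begin
    (b ᵥ* M) (suc j) - ((b ᵥ* M) zero * pivot⁻¹) * R j
      ≡⟨ rearrange ((b ᵥ* M) (suc j)) ((b ᵥ* M) zero) pivot⁻¹ (R j) ⟩
    (b ᵥ* M) (suc j) - (pivot⁻¹ * R j) * (b ᵥ* M) zero
      ≡⟨ ∑-linear (λ i → b i * M i (suc j)) (pivot⁻¹ * R j) (λ i → b i * M i zero) ⟨
    sum (λ i → b i * M i (suc j) - (pivot⁻¹ * R j) * (b i * M i zero))
      ≡⟨ sum-cong-≗ (λ i → distrib (b i) (M i (suc j)) (M i zero) pivot⁻¹ (R j)) ⟩
    (b ᵥ* M′) j ∎
    where
    open ≡-Reasoning
    rearrange : ∀ a s p ρ → a - (s * p) * ρ ≡ a - (p * ρ) * s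
    rearrange = solve 4 (λ a s p ρ → a :- (s :* p) :* ρ := a :- (p :* ρ) :* s) refl
    distrib : ∀ β x x₀ p ρ → β * x - (p * ρ) * (β * x₀) ≡ β * (x - (x₀ * p) * ρ)
    distrib = solve 5 (λ β x x₀ p ρ → β :* x :- (p :* ρ) :* (β :* x₀) := β :* (x :- (x₀ :* p) :* ρ)) refl

  eliminate-cancel : ∀ v y → eliminate v ≗ eliminate y → (λ j → v j + ((y zero - v zero) * pivot⁻¹) * M r j) ≗ y
  eliminate-cancel v y _ zero = begin
    v zero + ((y zero - v zero) * pivot⁻¹) * M r zero
      ≡⟨ solve 4 (λ a b p q → a :+ ((b :- a) :* p) :* q := a :+ (b :- a) :* (p :* q)) refl
                 (v zero) (y zero) pivot⁻¹ (M r zero) ⟩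
    v zero + (y zero - v zero) * (pivot⁻¹ * M r zero)
      ≡⟨ cong (λ s → v zero + (y zero - v zero) * s) pivot⁻¹*pivot≡1 ⟩
    v zero + (y zero - v zero) * 1ℚ
      ≡⟨ solve 2 (λ a b → a :+ (b :- a) :* con 1ℚ := b) refl (v zero) (y zero) ⟩
    y zero ∎
    where open ≡-Reasoning
  eliminate-cancel v y ev≗ey (suc j) = begin
    v (suc j) + ((y zero - v zero) * pivot⁻¹) * R j
      ≡⟨ solve 5 (λ a b c p ρ → a :+ ((b :- c) :* p) :* ρ := (a :- (c :* p) :* ρ) :+ (b :* p) :* ρ) refl
                 (v (suc j)) (y zero) (v zero) pivot⁻¹ (R j) ⟩
    eliminate v j + (y zero * pivot⁻¹) * R j
      ≡⟨ cong (_+ (y zero * pivot⁻¹) * R j) (ev≗ey j) ⟩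
    eliminate y j + (y zero * pivot⁻¹) * R j
      ≡⟨ solve 3 (λ a b ρ → (a :- b :* ρ) :+ b :* ρ := a) refl (y (suc j)) (y zero * pivot⁻¹) (R j) ⟩
    y (suc j) ∎
    where open ≡-Reasoning

  lift : ∀ y → InRowSpace M′ (eliminate y) ⊎ KernelWitness M′ (eliminate y) → InRowSpace M y ⊎ KernelWitness M y
  lift y (inj₁ (b , bM′≗ey)) =
    inj₁ ((λ i → b i + t * δ r i) , λ j → trans (ᵥ*-+δ b t r M j) (eliminate-cancel (b ᵥ* M) y ebM≗ey j))
    where
    t : ℚ
    t = (y zero - (b ᵥ* M) zero) * pivot⁻¹
    ebM≗ey : eliminate (b ᵥ* M) ≗ eliminate y
    ebM≗ey j = trans (eliminate-ᵥ* b j) (bM′≗ey j)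
  lift y (inj₂ (z , M′z≡0 , eyz≢0)) =
    inj₂ (extend z , (λ i → trans (extend-· (M i) z) (M′z≡0 i)) , eyz≢0 ∘ trans (sym (extend-· y z)))

fredholm : ∀ {n} m (M : Matrix n m) (y : Vector ℚ m) → InRowSpace M y ⊎ KernelWitness M y
fredholm zero    M y = inj₁ (const 0ℚ , λ ())
fredholm (suc m) M y with all? (λ i → M i zero ≟ 0ℚ)
... | yes col₀≡0 = zeroColumn M y col₀≡0 (fredholm m (tail ∘ M) (tail y))
... | no  col₀≢0 with ¬∀⟶∃¬ _ _ (λ i → M i zero ≟ 0ℚ) col₀≢0
...   | r , pivot≢0 = lift y (fredholm m M′ (eliminate y))
  where open Pivot M r pivot≢0

∑≡0⇒inRowSpace : ∀ {n m} (M : Matrix n m) → (∀ z → M *ᵥ z ≗ const 0ℚ → ∃[ c ] z ≗ const c) →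
                 ∀ y → sum y ≡ 0ℚ → InRowSpace M y
∑≡0⇒inRowSpace {m = m} M ker⊆𝟙 y ∑y≡0 with fredholm m M y
... | inj₁ y∈rowSpace = y∈rowSpace
... | inj₂ (z , Mz≡0 , yz≢0) with ker⊆𝟙 z Mz≡0
...   | c , z≗c = contradiction y·z≡0 yz≢0
  where
  open ≡-Reasoning
  y·z≡0 : y · z ≡ 0ℚ
  y·z≡0 = begin
    y · z               ≡⟨ sum-cong-≗ (λ j → cong (y j *_) (z≗c j)) ⟩
    sum (λ j → y j * c) ≡⟨ *-distribʳ-sum c y ⟨
    sum y * c           ≡⟨ cong (_* c) ∑y≡0 ⟩
    0ℚ * c              ≡⟨ ℚ.*-zeroˡ c ⟩
    0ℚ                  ∎

init≤maxFrom : ∀ {n} a (f : Vector ℚ n) → a ≤ maxFrom a f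
init≤maxFrom {zero}  a f = ≤-refl
init≤maxFrom {suc n} a f = ≤-trans (ℚ.p≤p⊔q a (f zero)) (init≤maxFrom (a ⊔ f zero) (f ∘ suc))

≤-maxFrom : ∀ {n} a (f : Vector ℚ n) i → f i ≤ maxFrom a f
≤-maxFrom a f zero    = ≤-trans (ℚ.p≤q⊔p a (f zero)) (init≤maxFrom (a ⊔ f zero) (f ∘ suc))
≤-maxFrom a f (suc i) = ≤-maxFrom (a ⊔ f zero) (f ∘ suc) i

≤-maxF : ∀ {n} (f : Vector ℚ (suc n)) i → f i ≤ maxF f
≤-maxF f zero    = init≤maxFrom (f zero) (f ∘ suc)
≤-maxF f (suc i) = ≤-maxFrom (f zero) (f ∘ suc) i

maxFrom-lub : ∀ {n a c} (f : Vector ℚ n) → a ≤ c → (∀ i → f i ≤ c) → maxFrom a f ≤ c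
maxFrom-lub {zero}  f a≤c f≤c = a≤c
maxFrom-lub {suc n} f a≤c f≤c = maxFrom-lub (f ∘ suc) (ℚ.⊔-lub a≤c (f≤c zero)) (f≤c ∘ suc)

maxF-lub : ∀ {n c} (f : Vector ℚ (suc n)) → (∀ i → f i ≤ c) → maxF f ≤ c
maxF-lub f f≤c = maxFrom-lub (f ∘ suc) (f≤c zero) (f≤c ∘ suc)

maxFrom-cong : ∀ {n} a {f g : Vector ℚ n} → f ≗ g → maxFrom a f ≡ maxFrom a g
maxFrom-cong {zero}  a         f≗g = refl
maxFrom-cong {suc n} a {f} {g} f≗g =
  trans (cong (λ b → maxFrom (a ⊔ b) (f ∘ suc)) (f≗g zero)) (maxFrom-cong (a ⊔ g zero) (f≗g ∘ suc))

maxF-cong : ∀ {n} {f g : Vector ℚ n} → f ≗ g → maxF f ≡ maxF g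
maxF-cong {zero}  f≗g = refl
maxF-cong {suc n} {f} {g} f≗g =
  trans (cong (λ a → maxFrom a (f ∘ suc)) (f≗g zero)) (maxFrom-cong (g zero) (f≗g ∘ suc))

-- The stability estimate

module ZeroSum {n} {x : Vector ℚ (suc n)} (∑x≡0 : sum x ≡ 0ℚ) {m} (x≤m : ∀ v → x v ≤ m) where

  K : ℚ
  K = sum {suc n} (const 1ℚ)

  0≤gap : ∀ v → 0ℚ ≤ m - x v
  0≤gap v = subst (_≤ m - x v) (ℚ.+-inverseʳ (x v)) (+-monoˡ-≤ (- x v) (x≤m v))

  ∑gap≡K*m : sum (λ v → m - x v) ≡ K * m
  ∑gap≡K*m = begin
    sum (λ v → m - x v)             ≡⟨ ∑-distrib-sub (const m) x ⟩
    sum {suc n} (const m) - sum x   ≡⟨ cong (λ s → sum {suc n} (const m) - s) ∑x≡0 ⟩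
    sum {suc n} (const m) - 0ℚ      ≡⟨ solve 1 (λ s → s :- con 0ℚ := s) refl (sum {suc n} (const m)) ⟩
    sum {suc n} (const m)           ≡⟨ sum-cong-≗ {suc n} (λ _ → ℚ.*-identityˡ m) ⟨
    sum {suc n} (const (1ℚ * m))    ≡⟨ *-distribʳ-sum m (const {B = Fin (suc n)} 1ℚ) ⟨
    K * m                           ∎
    where open ≡-Reasoning

  0≤K*m : 0ℚ ≤ K * m
  0≤K*m = subst (0ℚ ≤_) ∑gap≡K*m (∑-nonNeg 0≤gap)

  0≤m : 0ℚ ≤ m
  0≤m = ℚ.*-cancelˡ-≤-pos K {{positive 0<K}} (subst (_≤ K * m) (sym (ℚ.*-zeroʳ K)) 0≤K*m)
    where
    0<K : 0ℚ < K
    0<K = 0<1+p (∑-nonNeg {n} (λ _ → ℚ.nonNegative⁻¹ 1ℚ))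

  ∣x∣≤ : ∀ v → ∣ x v ∣ ≤ (1ℚ + K) * m
  ∣x∣≤ v = subst (∣ x v ∣ ≤_) (solve 2 (λ K m → m :+ K :* m := (con 1ℚ :+ K) :* m) refl K m)
    (∣p∣≤q (≤-trans (x≤m v) (p≤p+q 0≤K*m)) (begin
      - x v                ≤⟨ p≤q+p 0≤m ⟩
      m - x v              ≤⟨ ≤-∑ 0≤gap v ⟩
      sum (λ w → m - x w)  ≡⟨ ∑gap≡K*m ⟩
      K * m                ≤⟨ p≤q+p 0≤m ⟩
      m + K * m            ∎))
    where open ℚ.≤-Reasoning

·*ᵥ≡deviation : ∀ {k} (A : Matrix k k) (b : Vector ℚ k) i c → b ᵥ* A ≗ (λ j → δ i j - c) →
                ∀ p → sum p ≡ 1ℚ → b · (A *ᵥ p) ≡ p i - c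
·*ᵥ≡deviation A b i c bA≗δ-c p ∑p≡1 = begin
  b · (A *ᵥ p)            ≡⟨ ᵥ*-· b A p ⟨
  (b ᵥ* A) · p            ≡⟨ sum-cong-≗ (λ j → cong (_* p j) (bA≗δ-c j)) ⟩
  (λ j → δ i j - c) · p   ≡⟨ δ-const-· i c p ⟩
  p i - c * sum p         ≡⟨ cong (λ s → p i - c * s) ∑p≡1 ⟩
  p i - c * 1ℚ            ≡⟨ cong (λ s → p i - s) (ℚ.*-identityʳ c) ⟩
  p i - c                 ∎
  where open ≡-Reasoning

deviation-bound : ∀ {k} .{{_ : NonZero k}} (A : Matrix k k) →
  (∀ z → A *ᵥ z ≗ const 0ℚ → ∃[ c ] z ≗ const c) → (∀ p → sum (A *ᵥ p) ≡ 0ℚ) →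
  Σ[ C ∈ ℚ ] (0ℚ < C × ((p : Vector ℚ k) → sum p ≡ 1ℚ →
    ∀ i → ∣ p i - + 1 / k ∣ ≤ C * maxF (A *ᵥ p)))
deviation-bound {suc d} A ker⊆𝟙 ∑A*ᵥ≡0 = B * L , ℚ.positive⁻¹ (B * L) {{ℚ.pos*pos⇒pos B L}} , bound
  where
  u : ℚ
  u = + 1 / suc d

  solution : ∀ i → InRowSpace A (λ j → δ i j - u)
  solution i = ∑≡0⇒inRowSpace A ker⊆𝟙 (λ j → δ i j - u)
    (trans (∑-distrib-sub (δ i) (const u)) (trans (cong₂ _-_ (∑-δ i) (∑-1/n (suc d))) (ℚ.+-inverseʳ 1ℚ)))

  b : Fin (suc d) → Vector ℚ (suc d)
  b i = proj₁ (solution i)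

  B L : ℚ
  B = 1ℚ + sum (λ i → ‖ b i ‖₁)
  L = 1ℚ + sum {suc d} (const 1ℚ)

  instance
    B-pos : Positive B
    B-pos = positive (0<1+p (∑-nonNeg (λ i → ∑-nonNeg (λ v → ℚ.0≤∣p∣ (b i v)))))
    L-pos : Positive L
    L-pos = positive (0<1+p (∑-nonNeg {suc d} (λ _ → ℚ.nonNegative⁻¹ 1ℚ)))

  ‖b‖₁≤B : ∀ i → ‖ b i ‖₁ ≤ B
  ‖b‖₁≤B i = ≤-trans (≤-∑ (λ j → ∑-nonNeg (λ v → ℚ.0≤∣p∣ (b j v))) i) (p≤q+p (ℚ.nonNegative⁻¹ 1ℚ))

  bound : (p : Vector ℚ (suc d)) → sum p ≡ 1ℚ → ∀ i → ∣ p i - u ∣ ≤ (B * L) * maxF (A *ᵥ p)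
  bound p ∑p≡1 i = begin
    ∣ p i - u ∣          ≡⟨ cong ∣_∣ (·*ᵥ≡deviation A (b i) i u (proj₂ (solution i)) p ∑p≡1) ⟨
    ∣ b i · (A *ᵥ p) ∣   ≤⟨ ∣·∣≤‖‖₁* (b i) (A *ᵥ p) ∣x∣≤ ⟩
    ‖ b i ‖₁ * (L * m)   ≤⟨ *-monoʳ-≤-nonNeg (L * m) {{nonNegative 0≤L*m}} (‖b‖₁≤B i) ⟩
    B * (L * m)          ≡⟨ ℚ.*-assoc B L m ⟨
    (B * L) * m          ∎
    where
    open ℚ.≤-Reasoning
    m : ℚ
    m = maxF (A *ᵥ p)
    open ZeroSum (∑A*ᵥ≡0 p) (≤-maxF (A *ᵥ p)) using (∣x∣≤)
    0≤L*m : 0ℚ ≤ L * m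
    0≤L*m = ≤-trans (ℚ.0≤∣p∣ _) (∣x∣≤ zero)

skew⇒∑*ᵥ≡0 : ∀ {k} (A : Matrix k k) → (∀ i j → A j i ≡ - A i j) → A *ᵥ const 1ℚ ≗ const 0ℚ →
             ∀ p → sum (A *ᵥ p) ≡ 0ℚ
skew⇒∑*ᵥ≡0 A skew A𝟙≡0 p = begin
  sum (A *ᵥ p)                ≡⟨ sum-cong-≗ (λ i → ℚ.*-identityˡ ((A *ᵥ p) i)) ⟨
  const 1ℚ · (A *ᵥ p)         ≡⟨ ᵥ*-· (const 1ℚ) A p ⟨
  (const 1ℚ ᵥ* A) · p         ≡⟨ sum-cong-≗ (λ j → cong (_* p j) (𝟙A≡0 j)) ⟩
  const 0ℚ · p                ≡⟨ ·-comm (const 0ℚ) p ⟩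
  p · const 0ℚ                ≡⟨ ·-zeroʳ p ⟩
  0ℚ                          ∎
  where
  open ≡-Reasoning
  𝟙A≡0 : ∀ j → (const 1ℚ ᵥ* A) j ≡ 0ℚ
  𝟙A≡0 j = begin
    sum (λ i → 1ℚ * A i j)      ≡⟨ sum-cong-≗ (λ i → trans (cong (1ℚ *_) (skew j i)) (flip (A j i))) ⟩
    sum (λ i → - (A j i * 1ℚ))  ≡⟨ ∑-neg (λ i → A j i * 1ℚ) ⟩
    - (A *ᵥ const 1ℚ) j         ≡⟨ cong -_ (A𝟙≡0 j) ⟩
    0ℚ                          ∎
    where
    flip : ∀ a → 1ℚ * - a ≡ - (a * 1ℚ)
    flip a = solve 1 (λ a → con 1ℚ :* :- a := :- (a :* con 1ℚ)) refl a

kernel⊆𝟙 : ∀ {k} (A : Matrix k k) → KernelIsSpanOnes A → ∀ z → A *ᵥ z ≗ const 0ℚ → ∃[ c ] z ≗ const c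
kernel⊆𝟙 A ker≡𝟙 z Az≡0 with proj₁ (ker≡𝟙 z) (λ i → trans (Σ≡sum (λ j → A i j * z j)) (Az≡0 i))
... | c , z≡c*1 = c , λ j → trans (z≡c*1 j) (ℚ.*-identityʳ c)

𝟙⊆kernel : ∀ {k} (A : Matrix k k) → KernelIsSpanOnes A → A *ᵥ const 1ℚ ≗ const 0ℚ
𝟙⊆kernel A ker≡𝟙 i = trans (sym (Σ≡sum (λ j → A i j * 1ℚ))) (proj₂ (ker≡𝟙 (const 1ℚ)) (1ℚ , λ _ → refl) i)

skew-stability : ∀ {k} .{{_ : NonZero k}} (A : Matrix k k) →
  (∀ i j → A j i ≡ - A i j) → KernelIsSpanOnes A →
  Σ[ α ∈ ℚ ] (0ℚ < α × ((p : Vector ℚ k) → Σ p ≡ 1ℚ →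
    α * maxF (λ v → ∣ p v - + 1 / k ∣) ≤ maxF (mulVec A p)))
skew-stability {suc d} A skew ker≡𝟙 =
  let (C , 0<C , deviation≤C*max) =
        deviation-bound A (kernel⊆𝟙 A ker≡𝟙) (skew⇒∑*ᵥ≡0 A skew (𝟙⊆kernel A ker≡𝟙))
      (α , 0<α , α*≤) = inverse-bound 0<C
  in α , 0<α , λ p Σp≡1 →
       α*≤ (subst (λ m → maxF (λ v → ∣ p v - + 1 / suc d ∣) ≤ C * m)
                  (maxF-cong (λ i → sym (Σ≡sum (λ j → A i j * p j))))
                  (maxF-lub (λ v → ∣ p v - + 1 / suc d ∣) (deviation≤C*max p (trans (sym (Σ≡sum p)) Σp≡1))))

-- Skew adjacency matrices of digraphs

skewAdj-skew : ∀ {k} (D : Digraph k) i j → skewAdj D j i ≡ - skewAdj D i j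
skewAdj-skew D i j with arc D j i in ji | arc D i j in ij
... | true  | true  = contradiction (trans (sym ij) (antisym D j i ji)) λ ()
... | true  | false = refl
... | false | true  = refl
... | false | false = refl

outMinusIn≡mulVec : ∀ {k} (D : Digraph k) p v → outMinusIn D p v ≡ mulVec (skewAdj D) p v
outMinusIn≡mulVec D p v = begin
  Σ out - Σ in′                          ≡⟨ cong₂ _-_ (Σ≡sum out) (Σ≡sum in′) ⟩
  sum out - sum in′                      ≡⟨ ∑-distrib-sub out in′ ⟨
  sum (λ u → out u - in′ u)              ≡⟨ sum-cong-≗ arc-term ⟩
  sum (λ u → skewAdj D v u * p u)        ≡⟨ Σ≡sum (λ u → skewAdj D v u * p u) ⟨
  mulVec (skewAdj D) p v                 ∎
  where
  open ≡-Reasoning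
  out in′ : Vector ℚ _
  out u = if arc D v u then p u else 0ℚ
  in′ u = if arc D u v then p u else 0ℚ
  arc-term : ∀ u → out u - in′ u ≡ skewAdj D v u * p u
  arc-term u with arc D v u in vu | arc D u v in uv
  ... | true  | true  = contradiction (trans (sym uv) (antisym D v u vu)) λ ()
  ... | true  | false = solve 1 (λ q → q :- con 0ℚ := con 1ℚ :* q) refl (p u)
  ... | false | true  = solve 1 (λ q → con 0ℚ :- q := con (- 1ℚ) :* q) refl (p u)
  ... | false | false = solve 1 (λ q → con 0ℚ :- con 0ℚ := con 0ℚ :* q) refl (p u)

lemma3p2 : (k : ℕ) → .{{_ : NonZero k}} → (D : Digraph k) →
    KernelIsSpanOnes (skewAdj D) →
    Σ[ α ∈ ℚ ] (0ℚ < α ×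
      ((p : Fin k → ℚ) → (∀ v → 0ℚ ≤ p v) → Defs.Σ p ≡ 1ℚ →
        α * maxF (λ v → ∣ p v - (+ 1 / k) ∣) ≤ maxF (outMinusIn D p)))
lemma3p2 k D ker≡𝟙 =
  let (α , 0<α , bound) = skew-stability (skewAdj D) (skewAdj-skew D) ker≡𝟙
  in α , 0<α , λ p _ Σp≡1 →
       subst (α * maxF (λ v → ∣ p v - (+ 1 / k) ∣) ≤_)
             (maxF-cong (λ v → sym (outMinusIn≡mulVec D p v)))
             (bound p Σp≡1)
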